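{- Let $d\geq 4$, $k\geq 1$ and $n_1,\dots,n_{d-1}\geq 1$ be integers, and let $s_{k,n_1,\dots,n_{d-1}}$ be the number of parallelogram polyhypercubes of dimension $d$, width $k$, and whose $i$-th height equals $n_i$ for $i=1,\dots,d-1$. Then $$s_{k,n_1,\dots,n_{d-1}}=\frac{1}{k^{d-1}}\prod_{i=1}^{d-1}\frac{n_i}{n_i+k-1}\binom{n_i+k-1}{k-1}^2.$$
   Context: A $d$-dimensional polyhypercube is a finite set of unit hypercubes of $\mathbb{Z}^d$ (coordinates $(c_1,\dots,c_d)$), considered up to translation. A plateau is a set of cells with a single common first coordinate forming a full box $\{c: \beta_r\le c_r\le \tau_r \text{ for } 2\le r\le d\}$; for direction $r$ its bottom is $\beta_r$ and top $\tau_r$. A parallelogram polyhypercube of width $k$ is a union of $k$ plateaus $P_1,\dots,P_k$ at consecutive first coordinates $1,\dots,k$ such that for every $r\in\{2,\dots,d\}$ the bottoms $\beta_r(P_\ell)$ and tops $\tau_r(P_\ell)$ are weakly increasing in $\ell$ and $\beta_r(P_{\ell+1})\le\tau_r(P_\ell)$ for $1\le\ell\le k-1$. Its width is $k$ and its $i$-th height ($1\le i\le d-1$) is the number of distinct values of the coordinate $c_{i+1}$ among its cells, i.e. $\tau_{i+1}(P_k)-\beta_{i+1}(P_1)+1$. -}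

module Defs where

open import Data.Nat using (ℕ; zero; suc; _+_; _*_; _∸_; _≤_)
open import Data.Product using (_×_; _,_; proj₁; proj₂)
open import Data.Empty using (⊥)
open import Data.Vec using (Vec; []; _∷_; map; zipWith; replicate; foldr)
open import Data.Vec.Relation.Unary.All using (All)
open import Data.Vec.Relation.Binary.Pointwise.Inductive using (Pointwise)
open import Relation.Binary.PropositionalEquality using (_≡_)

-- A plateau in dimension d is described by its bottom/top pair (β_r, τ_r)
-- for each direction r = 2..d; there are m = d ∸ 1 such directions.
-- The plateau is the box {c : β_r ≤ c_r ≤ τ_r} at a fixed first coordinate.
Plateau : ℕ → Set
Plateau m = Vec (ℕ × ℕ) m

bottoms : ∀ {m} → Plateau m → Vec ℕ m
bottoms = map proj₁

tops : ∀ {m} → Plateau m → Vec ℕ m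
tops = map proj₂

NonEmpty : ∀ {m} → Plateau m → Set
NonEmpty P = All (λ bt → proj₁ bt ≤ proj₂ bt) P

StepRel : ℕ × ℕ → ℕ × ℕ → Set
StepRel (b , t) (b' , t') = (b ≤ b') × (t ≤ t') × (b' ≤ t)

Step : ∀ {m} → Plateau m → Plateau m → Set
Step P Q = Pointwise StepRel P Q

data Chain {m : ℕ} : ∀ {k} → Vec (Plateau m) k → Set where
  nil  : Chain []
  one  : ∀ {P} → Chain (P ∷ [])
  cons : ∀ {k P Q} {Ps : Vec (Plateau m) k} →
         Step P Q → Chain (Q ∷ Ps) → Chain (P ∷ Q ∷ Ps)

lastOr : ∀ {m k} → Plateau m → Vec (Plateau m) k → Plateau m
lastOr P []       = P
lastOr P (Q ∷ Qs) = lastOr Q Qs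

-- heights: the i-th height is τ_{i+1}(P_k) - β_{i+1}(P_1) + 1
-- (a width-0 family has no heights: it is not a polyhypercube of positive width)
HasHeights : ∀ {m k} → Vec (Plateau m) k → Vec ℕ m → Set
HasHeights []       ns = ⊥
HasHeights (P ∷ Ps) ns =
  zipWith (λ b t → suc t ∸ b) (bottoms P) (tops (lastOr P Ps)) ≡ ns

-- normalization modulo translation: the bottoms of the first plateau are 0
Normalized : ∀ {m k} → Vec (Plateau m) k → Set
Normalized []       = ⊥
Normalized {m} (P ∷ Ps) = bottoms P ≡ replicate m 0

-- Parallelogram polyhypercubes of dimension d, width k, heights ns
-- (one representative per translation class: plateau P_ℓ sits at first
-- coordinate ℓ, and β_r(P_1) = 0 for all r).
record ParPoly (d k : ℕ) (ns : Vec ℕ (d ∸ 1)) : Set where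
  constructor parpoly
  field
    plateaus   : Vec (Plateau (d ∸ 1)) k
    nonempty   : All NonEmpty plateaus
    chain      : Chain plateaus
    normalized : Normalized plateaus
    heights    : HasHeights plateaus ns

prodV : ∀ {m} → Vec ℕ m → ℕ
prodV = foldr _ _*_ 1

module Submission where

-- The directions are independent: for each r the bottoms and tops (β_r, τ_r) of the plateaus
-- form a parallelogram polyomino of width k (a chain of k columns, each overlapping and weakly
-- above its predecessor), and any d − 1 such polyominoes glue back together, so the count is
-- a product of polyomino counts.  Building a polyomino column by column gives a nested sum,
-- which by induction and the hockey-stick identity is the 2 × 2 determinant of binomials
--   C(j+x, j) C(j+1+y, j+1) − C(j+x, j+1) C(j+1+y, j)
-- counting pairs of non-crossing boundary paths (Lindström–Gessel–Viennot).  At j = k − 1,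
-- x = y = n − 1 the ratios between neighbouring binomials turn it into the Narayana number
-- n C(n+k−1, k−1)² / (k (n+k−1)).

open import Data.Empty using (⊥; ⊥-elim)
open import Data.Fin using (Fin; zero; suc; toℕ; fromℕ<)
open import Data.Fin.Properties using (toℕ≤pred[n]; toℕ-fromℕ<; toℕ-injective; +↔⊎; *↔×)
open import Data.Nat using (ℕ; zero; suc; _+_; _*_; _∸_; _^_; _≤_; _<_; z≤n; s≤s)
open import Data.Nat.Combinatorics using (_C_; nCk+nC[k+1]≡[n+1]C[k+1]; nC1≡n; k>n⇒nCk≡0)
open import Data.Nat.Properties hiding (≡-irrelevant)
open import Data.Nat.Tactic.RingSolver using (solve-∀)
open import Algebra.Properties.Semiring.Sum +-*-semiring
  using (sum; sum-syntax; sum-cong-≗; ∑-distrib-+; *-distribˡ-sum)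
open import Data.Product using (Σ; Σ-syntax; _×_; _,_; proj₁; proj₂)
open import Data.Product.Function.Dependent.Propositional using (Σ-↔)
open import Data.Product.Function.NonDependent.Propositional using (_×-↔_)
open import Data.Sum using (_⊎_; inj₁; inj₂)
open import Data.Sum.Function.Propositional using (_⊎-↔_)
open import Data.Vec using (Vec; []; _∷_; _++_; zipWith; map; replicate; take; drop)
open import Data.Vec.Properties
  using (∷-injectiveˡ; ++-injective; ++-injectiveˡ; ++-injectiveʳ; map-++; zipWith-++; take++drop≡id)
open import Data.Vec.Relation.Unary.All as All using (All; []; _∷_)
import Data.Vec.Relation.Unary.All.Properties as All
open import Data.Vec.Relation.Binary.Pointwise.Inductive as Pointwise using ([]; _∷_)
open import Function using (_∘_)
open import Function.Bundles using (_↔_; _⇔_; mk↔ₛ′; mk⇔; Equivalence)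
open import Function.Properties.Inverse using (↔-refl)
open import Function.Related.Propositional using (bijection; module EquationalReasoning)
open import Relation.Binary.PropositionalEquality
open import Relation.Binary.PropositionalEquality.WithK using (≡-irrelevant)
open import Relation.Nullary.Irrelevant using (Irrelevant)

open import Defs

-- Binomial coefficients and sums

[1+k]*[1+n]C[1+k]≡[1+n]*nCk : ∀ n k → suc k * (suc n C suc k) ≡ suc n * (n C k)
[1+k]*[1+n]C[1+k]≡[1+n]*nCk n       zero    = trans (+-identityʳ _) (trans (nC1≡n (suc n)) (sym (*-identityʳ (suc n))))
[1+k]*[1+n]C[1+k]≡[1+n]*nCk zero    (suc k) = *-zeroʳ (2 + k)
[1+k]*[1+n]C[1+k]≡[1+n]*nCk (suc n) (suc k) = begin
  suc (suc k) * (suc (suc n) C suc (suc k))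
    ≡⟨ cong (suc (suc k) *_) (nCk+nC[k+1]≡[n+1]C[k+1] (suc n) (suc k)) ⟨
  suc (suc k) * (a + b)
    ≡⟨ expand (suc k) a b ⟩
  a + (suc k * a + suc (suc k) * b)
    ≡⟨ cong₂ (λ u v → a + (u + v)) ([1+k]*[1+n]C[1+k]≡[1+n]*nCk n k) ([1+k]*[1+n]C[1+k]≡[1+n]*nCk n (suc k)) ⟩
  a + (suc n * (n C k) + suc n * (n C suc k))
    ≡⟨ cong (a +_) (*-distribˡ-+ (suc n) (n C k) (n C suc k)) ⟨
  a + suc n * (n C k + n C suc k)
    ≡⟨ cong (λ u → a + suc n * u) (nCk+nC[k+1]≡[n+1]C[k+1] n k) ⟩
  suc (suc n) * a ∎
  where
  open ≡-Reasoning
  a = suc n C suc k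
  b = suc n C suc (suc k)
  expand : ∀ k a b → suc k * (a + b) ≡ a + (k * a + suc k * b)
  expand = solve-∀

[1+k]*[k+n]C[1+k]≡n*[k+n]Ck : ∀ n k → suc k * ((k + n) C suc k) ≡ n * ((k + n) C k)
[1+k]*[k+n]C[1+k]≡n*[k+n]Ck n k = +-cancelʳ-≡ (suc k * c) (suc k * c′) (n * c) (begin
  suc k * c′ + suc k * c              ≡⟨ +-comm (suc k * c′) (suc k * c) ⟩
  suc k * c + suc k * c′              ≡⟨ *-distribˡ-+ (suc k) c c′ ⟨
  suc k * (c + c′)                    ≡⟨ cong (suc k *_) (nCk+nC[k+1]≡[n+1]C[k+1] (k + n) k) ⟩
  suc k * (suc (k + n) C suc k)       ≡⟨ [1+k]*[1+n]C[1+k]≡[1+n]*nCk (k + n) k ⟩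
  (suc k + n) * c                     ≡⟨ cong (_* c) (+-comm (suc k) n) ⟩
  (n + suc k) * c                     ≡⟨ *-distribʳ-+ c n (suc k) ⟩
  n * c + suc k * c ∎)
  where
  open ≡-Reasoning
  c  = (k + n) C k
  c′ = (k + n) C suc k

hockey-stick : ∀ a m n → ∑[ i < n ] ((a + toℕ i) C m) + a C suc m ≡ (a + n) C suc m
hockey-stick a m zero    = cong (_C suc m) (sym (+-identityʳ a))
hockey-stick a m (suc n) = begin
  (a + 0) C m + S + a C suc m
    ≡⟨ cong (λ x → x C m + S + a C suc m) (+-identityʳ a) ⟩
  a C m + S + a C suc m
    ≡⟨ rotate (a C m) S (a C suc m) ⟩
  S + (a C m + a C suc m)
    ≡⟨ cong (S +_) (nCk+nC[k+1]≡[n+1]C[k+1] a m) ⟩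
  S + suc a C suc m
    ≡⟨ cong (_+ suc a C suc m) (sum-cong-≗ {n} (λ i → cong (_C m) (+-suc a (toℕ i)))) ⟩
  ∑[ i < n ] ((suc a + toℕ i) C m) + suc a C suc m
    ≡⟨ hockey-stick (suc a) m n ⟩
  (suc a + n) C suc m
    ≡⟨ cong (_C suc m) (+-suc a n) ⟨
  (a + suc n) C suc m ∎
  where
  open ≡-Reasoning
  S = ∑[ i < n ] ((a + suc (toℕ i)) C m)
  rotate : ∀ x y z → x + y + z ≡ y + (x + z)
  rotate = solve-∀

hockey-stick-vanishing : ∀ j m x → j ≤ m → ∑[ e < suc x ] ((j + toℕ e) C m) ≡ (suc j + x) C suc m
hockey-stick-vanishing j m x j≤m = begin
  ∑[ e < suc x ] ((j + toℕ e) C m)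
    ≡⟨ +-identityʳ _ ⟨
  ∑[ e < suc x ] ((j + toℕ e) C m) + 0
    ≡⟨ cong (∑[ e < suc x ] ((j + toℕ e) C m) +_) (k>n⇒nCk≡0 (s≤s j≤m)) ⟨
  ∑[ e < suc x ] ((j + toℕ e) C m) + j C suc m
    ≡⟨ hockey-stick j m (suc x) ⟩
  (j + suc x) C suc m
    ≡⟨ cong (_C suc m) (+-suc j x) ⟩
  (suc j + x) C suc m ∎
  where open ≡-Reasoning

hockey-stick-range : ∀ a m {x y} → x ≤ y →
  ∑[ i < suc (y ∸ x) ] ((a + (x + toℕ i)) C m) + (a + x) C suc m ≡ (suc a + y) C suc m
hockey-stick-range a m {x} {y} x≤y = begin
  ∑[ i < suc (y ∸ x) ] ((a + (x + toℕ i)) C m) + (a + x) C suc m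
    ≡⟨ cong (_+ (a + x) C suc m) (sum-cong-≗ {suc (y ∸ x)} (λ i → cong (_C m) (+-assoc a x (toℕ i)))) ⟨
  ∑[ i < suc (y ∸ x) ] ((a + x + toℕ i) C m) + (a + x) C suc m
    ≡⟨ hockey-stick (a + x) m (suc (y ∸ x)) ⟩
  (a + x + suc (y ∸ x)) C suc m
    ≡⟨ cong (_C suc m) (trans (+-suc (a + x) (y ∸ x)) (cong suc (+-assoc a x (y ∸ x)))) ⟩
  (suc a + (x + (y ∸ x))) C suc m
    ≡⟨ cong (λ z → (suc a + z) C suc m) (m+[n∸m]≡n x≤y) ⟩
  (suc a + y) C suc m ∎
  where open ≡-Reasoning

∑-linearˡ : ∀ {n} (f g h : Fin n → ℕ) c d → (∀ i → f i + c * g i ≡ d * h i) → sum f + c * sum g ≡ d * sum h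
∑-linearˡ f g h c d eq = begin
  sum f + c * sum g            ≡⟨ cong (sum f +_) (*-distribˡ-sum c g) ⟩
  sum f + sum (λ i → c * g i)  ≡⟨ ∑-distrib-+ f (λ i → c * g i) ⟨
  sum (λ i → f i + c * g i)    ≡⟨ sum-cong-≗ eq ⟩
  sum (λ i → d * h i)          ≡⟨ *-distribˡ-sum d h ⟨
  d * sum h                    ∎
  where open ≡-Reasoning

∑-linearʳ : ∀ {n} (f g h : Fin n → ℕ) c d → (∀ i → f i + g i * c ≡ h i * d) → sum f + sum g * c ≡ sum h * d
∑-linearʳ f g h c d eq = begin
  sum f + sum g * c  ≡⟨ cong (sum f +_) (*-comm (sum g) c) ⟩
  sum f + c * sum g  ≡⟨ ∑-linearˡ f g h c d eq′ ⟩
  d * sum h          ≡⟨ *-comm d (sum h) ⟩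
  sum h * d          ∎
  where
  open ≡-Reasoning
  eq′ : ∀ i → f i + c * g i ≡ d * h i
  eq′ i = trans (cong (f i +_) (*-comm c (g i))) (trans (eq i) (*-comm (h i) d))

-- Multiplying s = M A − B P by K Q and using the three ratios gives (N+1)² P² − N (N+1) P².
determinant-closed-form : ∀ s N K Q M A B P →
  s + B * P ≡ M * A → K * A ≡ Q * M → K * A ≡ suc N * P → K * B ≡ N * M →
  K * Q * s ≡ suc N * (P * P)
determinant-closed-form s N K Q M A B P det KA≡QM KA≡[1+N]P KB≡NM =
  +-cancelʳ-≡ (N * suc N * (P * P)) (K * Q * s) (suc N * (P * P)) (begin
    K * Q * s + N * suc N * (P * P)    ≡⟨ cong (K * Q * s +_) correction ⟨
    K * Q * s + Q * P * (K * B)        ≡⟨ factor K Q s B P ⟩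
    K * Q * (s + B * P)                ≡⟨ cong (K * Q *_) det ⟩
    K * Q * (M * A)                    ≡⟨ regroup K Q M A ⟩
    Q * M * (K * A)                    ≡⟨ cong (_* (K * A)) KA≡QM ⟨
    K * A * (K * A)                    ≡⟨ cong₂ _*_ KA≡[1+N]P KA≡[1+N]P ⟩
    suc N * P * (suc N * P)            ≡⟨ square N P ⟩
    suc N * (P * P) + N * suc N * (P * P) ∎)
  where
  open ≡-Reasoning
  factor : ∀ k q s b p → k * q * s + q * p * (k * b) ≡ k * q * (s + b * p)
  factor = solve-∀
  regroup : ∀ k q m a → k * q * (m * a) ≡ q * m * (k * a)
  regroup = solve-∀
  square : ∀ n p → suc n * p * (suc n * p) ≡ suc n * (p * p) + n * suc n * (p * p)
  square = solve-∀
  correction : Q * P * (K * B) ≡ N * suc N * (P * P)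
  correction = begin
    Q * P * (K * B)      ≡⟨ cong (Q * P *_) KB≡NM ⟩
    Q * P * (N * M)      ≡⟨ regroup Q P N M ⟩
    P * N * (Q * M)      ≡⟨ cong (P * N *_) KA≡QM ⟨
    P * N * (K * A)      ≡⟨ cong (P * N *_) KA≡[1+N]P ⟩
    P * N * (suc N * P)  ≡⟨ regroup P N (suc N) P ⟩
    N * suc N * (P * P)  ∎

-- Counting column chains

-- countColumns l x y counts the chains of l + 1 columns that follow a column [b, t] and end
-- at height N, in the depths x = N ∸ t ≤ y = N ∸ b below N (see Fin-countColumns↔Columns);
-- in these coordinates the count does not depend on N.
countColumns : ℕ → ℕ → ℕ → ℕ
countColumns zero    x y = suc (y ∸ x)
countColumns (suc l) x y = ∑[ i < suc (y ∸ x) ] ∑[ e < suc x ] countColumns l (toℕ e) (x + toℕ i)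

countColumns-det : ∀ j {x y} → x ≤ y →
  countColumns j x y + ((j + x) C suc j) * ((suc j + y) C j) ≡ ((j + x) C j) * ((suc j + y) C suc j)
countColumns-det zero {x} {y} x≤y = begin
  suc (y ∸ x) + (x C 1) * 1 ≡⟨ cong (suc (y ∸ x) +_) (trans (*-identityʳ (x C 1)) (nC1≡n x)) ⟩
  suc (y ∸ x) + x           ≡⟨ cong suc (m∸n+n≡m x≤y) ⟩
  suc y                     ≡⟨ trans (+-identityʳ _) (nC1≡n (suc y)) ⟨
  1 * (suc y C 1)           ∎
  where open ≡-Reasoning
countColumns-det (suc j) {x} {y} x≤y = begin
  sum G + B * ((2+j + y) C suc j)    ≡⟨ cong (λ z → sum G + B * z) (hockey-stick-range (suc j) j x≤y) ⟨
  sum G + B * (sum (Q j) + A)        ≡⟨ cong (sum G +_) (*-distribˡ-+ B (sum (Q j)) A) ⟩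
  sum G + (B * sum (Q j) + B * A)    ≡⟨ +-assoc (sum G) (B * sum (Q j)) (B * A) ⟨
  sum G + B * sum (Q j) + B * A      ≡⟨ cong₂ _+_ (∑-linearˡ G (Q j) (Q (suc j)) B A row) (*-comm B A) ⟩
  A * sum (Q (suc j)) + A * B        ≡⟨ *-distribˡ-+ A (sum (Q (suc j))) B ⟨
  A * (sum (Q (suc j)) + B)          ≡⟨ cong (A *_) (hockey-stick-range (suc j) (suc j) x≤y) ⟩
  A * ((2+j + y) C suc (suc j))      ∎
  where
  open ≡-Reasoning
  2+j = suc (suc j)
  A = (suc j + x) C suc j
  B = (suc j + x) C suc (suc j)
  G : Fin (suc (y ∸ x)) → ℕ
  G i = ∑[ e < suc x ] countColumns j (toℕ e) (x + toℕ i)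
  Q : ℕ → Fin (suc (y ∸ x)) → ℕ
  Q m i = (suc j + (x + toℕ i)) C m
  -- the induction hypothesis summed over the depth e ≤ x of the first column's top
  row : ∀ i → G i + B * Q j i ≡ A * Q (suc j) i
  row i = subst₂ (λ b a → G i + b * Q j i ≡ a * Q (suc j) i)
    (hockey-stick-vanishing j (suc j) x (n≤1+n j)) (hockey-stick-vanishing j j x ≤-refl)
    (∑-linearʳ {suc x} (λ e → countColumns j (toℕ e) (x + toℕ i))
      (λ e → (j + toℕ e) C suc j) (λ e → (j + toℕ e) C j)
      (Q j i) (Q (suc j) i) (λ e → countColumns-det j (≤-trans (toℕ≤pred[n] e) (m≤m+n x (toℕ i)))))

parallelogramCount : ℕ → ℕ → ℕ
parallelogramCount (suc k) (suc N) = countColumns k N N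
parallelogramCount _       _       = 0

parallelogramCount-formula : ∀ k n →
  suc k * (n + suc k ∸ 1) * parallelogramCount (suc k) n ≡ n * ((n + suc k ∸ 1) C k) ^ 2
parallelogramCount-formula k zero    = *-zeroʳ (suc k * k)
parallelogramCount-formula k (suc N) = begin
  suc k * (N + suc k) * countColumns k N N
    ≡⟨ cong (λ q → suc k * q * countColumns k N N) (+-comm N (suc k)) ⟩
  suc k * (suc k + N) * countColumns k N N
    ≡⟨ determinant-closed-form (countColumns k N N) N (suc k) (suc k + N) M A B P det KA≡QM KA≡[1+N]P KB≡NM ⟩
  suc N * (P * P)
    ≡⟨ cong (λ p → suc N * (p * p)) (cong (_C k) (+-comm (suc k) N)) ⟩
  suc N * (P′ * P′)
    ≡⟨ cong (λ p → suc N * (P′ * p)) (*-identityʳ P′) ⟨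
  suc N * P′ ^ 2 ∎
  where
  open ≡-Reasoning
  M = (k + N) C k
  B = (k + N) C suc k
  A = (suc k + N) C suc k
  P = (suc k + N) C k
  P′ = (N + suc k) C k
  det : countColumns k N N + B * P ≡ M * A
  det = countColumns-det k ≤-refl
  KA≡QM : suc k * A ≡ (suc k + N) * M
  KA≡QM = [1+k]*[1+n]C[1+k]≡[1+n]*nCk (k + N) k
  KA≡[1+N]P : suc k * A ≡ suc N * P
  KA≡[1+N]P = subst (λ m → suc k * (m C suc k) ≡ suc N * (m C k)) (+-suc k N) ([1+k]*[k+n]C[1+k]≡n*[k+n]Ck (suc N) k)
  KB≡NM : suc k * B ≡ N * M
  KB≡NM = [1+k]*[k+n]C[1+k]≡n*[k+n]Ck N k

∏-parallelogramCount-formula : ∀ {m} k (ns : Vec ℕ m) →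
  suc k ^ m * prodV (map (λ n → n + suc k ∸ 1) ns) * prodV (map (parallelogramCount (suc k)) ns)
    ≡ prodV (map (λ n → n * ((n + suc k ∸ 1) C k) ^ 2) ns)
∏-parallelogramCount-formula k []       = refl
∏-parallelogramCount-formula {suc m} k (n ∷ ns) =
  trans (interchange (suc k) (suc k ^ m) (n + suc k ∸ 1) (prodV (map (λ n → n + suc k ∸ 1) ns))
                     (parallelogramCount (suc k) n) (prodV (map (parallelogramCount (suc k)) ns)))
        (cong₂ _*_ (parallelogramCount-formula k n) (∏-parallelogramCount-formula k ns))
  where
  interchange : ∀ k K a A s S → k * K * (a * A) * (s * S) ≡ (k * a * s) * (K * A * S)
  interchange = solve-∀

×-irrelevant : ∀ {A B : Set} → Irrelevant A → Irrelevant B → Irrelevant (A × B)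
×-irrelevant irrA irrB (a , b) (a′ , b′) = cong₂ _,_ (irrA a a′) (irrB b b′)

irrelevant-⇔⇒↔ : ∀ {A B : Set} → Irrelevant A → Irrelevant B → A ⇔ B → A ↔ B
irrelevant-⇔⇒↔ irrA irrB A⇔B = mk↔ₛ′ to from (λ b → irrB _ b) (λ a → irrA _ a)
  where open Equivalence A⇔B

Σ-Fin-suc↔ : ∀ {n} (B : Fin (suc n) → Set) → (B zero ⊎ Σ (Fin n) (B ∘ suc)) ↔ Σ (Fin (suc n)) B
Σ-Fin-suc↔ B = mk↔ₛ′ to from to∘from from∘to
  where
  to : B zero ⊎ Σ _ (B ∘ suc) → Σ _ B
  to (inj₁ b)       = zero , b
  to (inj₂ (i , b)) = suc i , b
  from : Σ _ B → B zero ⊎ Σ _ (B ∘ suc)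
  from (zero  , b) = inj₁ b
  from (suc i , b) = inj₂ (i , b)
  to∘from : ∀ x → to (from x) ≡ x
  to∘from (zero  , b) = refl
  to∘from (suc i , b) = refl
  from∘to : ∀ x → from (to x) ≡ x
  from∘to (inj₁ b)       = refl
  from∘to (inj₂ (i , b)) = refl

Fin-sum↔Σ : ∀ n (f : Fin n → ℕ) → Fin (sum f) ↔ Σ (Fin n) (Fin ∘ f)
Fin-sum↔Σ zero    f = mk↔ₛ′ (λ ()) (λ ()) (λ ()) (λ ())
Fin-sum↔Σ (suc n) f = begin
  Fin (f zero + sum (f ∘ suc))                 ↔⟨ +↔⊎ ⟩
  (Fin (f zero) ⊎ Fin (sum (f ∘ suc)))         ↔⟨ ↔-refl ⊎-↔ Fin-sum↔Σ n (f ∘ suc) ⟩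
  (Fin (f zero) ⊎ Σ (Fin n) (Fin ∘ f ∘ suc))   ↔⟨ Σ-Fin-suc↔ (Fin ∘ f) ⟩
  Σ (Fin (suc n)) (Fin ∘ f) ∎
  where open EquationalReasoning {k = bijection}

Σ×Σ↔Σ× : ∀ {A B : Set} {P : A → Set} {Q : B → Set} →
  (Σ A P × Σ B Q) ↔ Σ (A × B) (λ (x , y) → P x × Q y)
Σ×Σ↔Σ× = mk↔ₛ′ (λ ((x , p) , (y , q)) → (x , y) , p , q) (λ ((x , y) , p , q) → (x , p) , (y , q))
  (λ _ → refl) (λ _ → refl)

∸-flip : ∀ {m n o} → n ≤ o → m ≤ o ∸ n → n ≤ o ∸ m
∸-flip {m} {n} {o} n≤o m≤o∸n =
  m+n≤o⇒m≤o∸n n (subst (_≤ o) (+-comm m n) (m≤o∸n⇒m+n≤o m n≤o m≤o∸n))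

∸-split : ∀ {N b t} → b ≤ t → t ≤ N → N ∸ b ≡ N ∸ t + (t ∸ b)
∸-split {N} {b} {t} b≤t t≤N = trans (cong (_∸ b) (sym (m∸n+n≡m t≤N))) (+-∸-assoc (N ∸ t) b≤t)

∸-gap : ∀ {N b t} → b ≤ t → t ≤ N → (N ∸ b) ∸ (N ∸ t) ≡ t ∸ b
∸-gap {N} {b} {t} b≤t t≤N = trans (cong (_∸ (N ∸ t)) (∸-split b≤t t≤N)) (m+n∸m≡n (N ∸ t) (t ∸ b))

Interval : ℕ → ℕ → Set
Interval lo hi = Σ[ z ∈ ℕ ] (lo ≤ z × z ≤ hi)

Interval-≡ : ∀ {lo hi} {u v : Interval lo hi} → proj₁ u ≡ proj₁ v → u ≡ v
Interval-≡ {u = z , p , q} {.z , p′ , q′} refl =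
  cong₂ (λ p q → z , p , q) (≤-irrelevant p p′) (≤-irrelevant q q′)

-- The reflected enumeration i ↦ hi ∸ i matches the depth coordinates of countColumns.
Fin↔Interval : ∀ {lo hi} → lo ≤ hi → Fin (suc (hi ∸ lo)) ↔ Interval lo hi
Fin↔Interval {lo} {hi} lo≤hi = mk↔ₛ′ to from to∘from from∘to
  where
  to : Fin (suc (hi ∸ lo)) → Interval lo hi
  to i = hi ∸ toℕ i , lo≤hi∸i , m∸n≤m hi (toℕ i)
    where
    lo≤hi∸i : lo ≤ hi ∸ toℕ i
    lo≤hi∸i = ∸-flip lo≤hi (toℕ≤pred[n] i)
  reflected< : ∀ {z} → lo ≤ z → hi ∸ z < suc (hi ∸ lo)
  reflected< lo≤z = s≤s (∸-monoʳ-≤ hi lo≤z)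
  from : Interval lo hi → Fin (suc (hi ∸ lo))
  from (z , lo≤z , _) = fromℕ< (reflected< lo≤z)
  to∘from : ∀ u → to (from u) ≡ u
  to∘from (z , lo≤z , z≤hi) =
    Interval-≡ (trans (cong (hi ∸_) (toℕ-fromℕ< (reflected< lo≤z))) (m∸[m∸n]≡n z≤hi))
  from∘to : ∀ i → from (to i) ≡ i
  from∘to i = toℕ-injective (trans (toℕ-fromℕ< _) (m∸[m∸n]≡n (≤-trans (toℕ≤pred[n] i) (m∸n≤m hi lo))))

-- Parallelogram polyhypercubes

take-++ : ∀ {A : Set} {a b} (xs : Vec A a) (ys : Vec A b) → take a (xs ++ ys) ≡ xs
take-++ {a = a} xs ys = ++-injectiveˡ (take a (xs ++ ys)) xs (take++drop≡id a (xs ++ ys))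

drop-++ : ∀ {A : Set} {a b} (xs : Vec A a) (ys : Vec A b) → drop a (xs ++ ys) ≡ ys
drop-++ {a = a} xs ys = ++-injectiveʳ (take a (xs ++ ys)) xs (take++drop≡id a (xs ++ ys))

replicate-++ : ∀ {A : Set} a {b} (x : A) → replicate (a + b) x ≡ replicate a x ++ replicate b x
replicate-++ zero    x = refl
replicate-++ (suc a) x = cong (x ∷_) (replicate-++ a x)

IsParPoly : ∀ {m k} → Vec ℕ m → Vec (Plateau m) k → Set
IsParPoly ns Ps = All NonEmpty Ps × Chain Ps × Normalized Ps × HasHeights Ps ns

ParPoly↔Σ : ∀ {d k ns} → ParPoly d k ns ↔ Σ (Vec (Plateau (d ∸ 1)) k) (IsParPoly ns)
ParPoly↔Σ = mk↔ₛ′ (λ (parpoly Ps ne c z h) → Ps , ne , c , z , h) (λ (Ps , ne , c , z , h) → parpoly Ps ne c z h)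
  (λ _ → refl) (λ _ → refl)

StepRel-irrelevant : ∀ {c c′} → Irrelevant (StepRel c c′)
StepRel-irrelevant = ×-irrelevant ≤-irrelevant (×-irrelevant ≤-irrelevant ≤-irrelevant)

Step-irrelevant : ∀ {m} {P Q : Plateau m} → Irrelevant (Step P Q)
Step-irrelevant []       []         = refl
Step-irrelevant (r ∷ rs) (r′ ∷ rs′) = cong₂ _∷_ (StepRel-irrelevant r r′) (Step-irrelevant rs rs′)

Chain-irrelevant : ∀ {m k} {Ps : Vec (Plateau m) k} → Irrelevant (Chain Ps)
Chain-irrelevant nil        nil          = refl
Chain-irrelevant one        one          = refl
Chain-irrelevant (cons s c) (cons s′ c′) = cong₂ cons (Step-irrelevant s s′) (Chain-irrelevant c c′)

IsParPoly-irrelevant : ∀ {m k ns} {Ps : Vec (Plateau m) k} → Irrelevant (IsParPoly ns Ps)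
IsParPoly-irrelevant {Ps = []}    (_ , _ , () , _)
IsParPoly-irrelevant {Ps = _ ∷ _} =
  ×-irrelevant (All.irrelevant (All.irrelevant ≤-irrelevant))
    (×-irrelevant Chain-irrelevant (×-irrelevant ≡-irrelevant ≡-irrelevant))

ParPoly-≡ : ∀ {d k ns} {p q : ParPoly d k ns} → ParPoly.plateaus p ≡ ParPoly.plateaus q → p ≡ q
ParPoly-≡ {p = parpoly Ps ne c z h} {parpoly _ ne′ c′ z′ h′} refl =
  cong (λ (ne , c , z , h) → parpoly Ps ne c z h) (IsParPoly-irrelevant (ne , c , z , h) (ne′ , c′ , z′ , h′))

Chain-tail : ∀ {m k} {P : Plateau m} {Ps : Vec (Plateau m) k} → Chain (P ∷ Ps) → Chain Ps
Chain-tail one        = nil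
Chain-tail (cons _ c) = c

-- HasHeights (P ∷ Ps) ns unfolds to extent P (lastOr P Ps) ≡ ns.
extent : ∀ {m} → Plateau m → Plateau m → Vec ℕ m
extent B L = zipWith (λ b t → suc t ∸ b) (bottoms B) (tops L)

module _ {a b : ℕ} where

  extent-++ : (B L : Plateau a) (B′ L′ : Plateau b) → extent (B ++ B′) (L ++ L′) ≡ extent B L ++ extent B′ L′
  extent-++ B L B′ L′ =
    trans (cong₂ (zipWith (λ b t → suc t ∸ b)) (map-++ proj₁ B B′) (map-++ proj₂ L L′))
          (zipWith-++ _ (bottoms B) (bottoms B′) (tops L) (tops L′))

  zip-++↔ : ∀ {k} → (Vec (Plateau a) k × Vec (Plateau b) k) ↔ Vec (Plateau (a + b)) k
  zip-++↔ = mk↔ₛ′ (λ (Hs , Ts) → zipWith _++_ Hs Ts) (λ Ps → map (take a) Ps , map (drop a) Ps)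
    join∘split split∘join
    where
    join∘split : ∀ {k} (Ps : Vec (Plateau (a + b)) k) → zipWith _++_ (map (take a) Ps) (map (drop a) Ps) ≡ Ps
    join∘split []       = refl
    join∘split (P ∷ Ps) = cong₂ _∷_ (take++drop≡id a P) (join∘split Ps)
    split∘join : ∀ {k} (HTs : Vec (Plateau a) k × Vec (Plateau b) k) →
      let Ps = zipWith _++_ (proj₁ HTs) (proj₂ HTs) in (map (take a) Ps , map (drop a) Ps) ≡ HTs
    split∘join ([]     , [])     = refl
    split∘join (H ∷ Hs , T ∷ Ts) =
      cong₂ (λ (H′ , T′) (Hs′ , Ts′) → H′ ∷ Hs′ , T′ ∷ Ts′)
        (cong₂ _,_ (take-++ H T) (drop-++ H T)) (split∘join (Hs , Ts))

  All-NonEmpty-zip⁻ : ∀ {k} (Hs : Vec (Plateau a) k) (Ts : Vec (Plateau b) k) →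
    All NonEmpty (zipWith _++_ Hs Ts) → All NonEmpty Hs × All NonEmpty Ts
  All-NonEmpty-zip⁻ []       []       []       = [] , []
  All-NonEmpty-zip⁻ (H ∷ Hs) (T ∷ Ts) (p ∷ ps) =
    let (pH , pT) = All.++⁻ H p ; (pHs , pTs) = All-NonEmpty-zip⁻ Hs Ts ps in pH ∷ pHs , pT ∷ pTs

  Chain-zip⁺ : ∀ {k} {Hs : Vec (Plateau a) k} {Ts : Vec (Plateau b) k} →
    Chain Hs → Chain Ts → Chain (zipWith _++_ Hs Ts)
  Chain-zip⁺ nil         nil         = nil
  Chain-zip⁺ one         one         = one
  Chain-zip⁺ (cons s cH) (cons r cT) = cons (Pointwise.++⁺ s r) (Chain-zip⁺ cH cT)

  Chain-zip⁻ : ∀ {k} (Hs : Vec (Plateau a) k) (Ts : Vec (Plateau b) k) →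
    Chain (zipWith _++_ Hs Ts) → Chain Hs × Chain Ts
  Chain-zip⁻ []            []            nil        = nil , nil
  Chain-zip⁻ (_ ∷ [])      (_ ∷ [])      one        = one , one
  Chain-zip⁻ (H ∷ H′ ∷ Hs) (T ∷ T′ ∷ Ts) (cons s c) =
    let (sH , sT) = Pointwise.++⁻ H H′ s ; (cH , cT) = Chain-zip⁻ (H′ ∷ Hs) (T′ ∷ Ts) c in cons sH cH , cons sT cT

  Normalized-zip⇔ : ∀ {k} (Hs : Vec (Plateau a) k) (Ts : Vec (Plateau b) k) →
    Normalized (zipWith _++_ Hs Ts) ⇔ (Normalized Hs × Normalized Ts)
  Normalized-zip⇔ []      []      = mk⇔ (λ ()) (λ ())
  Normalized-zip⇔ (H ∷ _) (T ∷ _) = mk⇔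
    (λ e → ++-injective (bottoms H) (replicate a 0) (trans (sym (map-++ proj₁ H T)) (trans e (replicate-++ a 0))))
    (λ (eH , eT) → trans (map-++ proj₁ H T) (trans (cong₂ _++_ eH eT) (sym (replicate-++ a 0))))

  lastOr-zip : ∀ {k} (H : Plateau a) (T : Plateau b) (Hs : Vec (Plateau a) k) (Ts : Vec (Plateau b) k) →
    lastOr (H ++ T) (zipWith _++_ Hs Ts) ≡ lastOr H Hs ++ lastOr T Ts
  lastOr-zip H T []        []        = refl
  lastOr-zip H T (H′ ∷ Hs) (T′ ∷ Ts) = lastOr-zip H′ T′ Hs Ts

  HasHeights-zip⇔ : ∀ {k} (Hs : Vec (Plateau a) k) (Ts : Vec (Plateau b) k) {ns ms} →
    HasHeights (zipWith _++_ Hs Ts) (ns ++ ms) ⇔ (HasHeights Hs ns × HasHeights Ts ms)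
  HasHeights-zip⇔ []       []       = mk⇔ (λ ()) (λ ())
  HasHeights-zip⇔ (H ∷ Hs) (T ∷ Ts) {ns} = mk⇔
    (λ e → ++-injective (extent H (lastOr H Hs)) ns (trans (sym extent-zip) e))
    (λ (eH , eT) → trans extent-zip (cong₂ _++_ eH eT))
    where
    extent-zip : extent (H ++ T) (lastOr (H ++ T) (zipWith _++_ Hs Ts)) ≡ extent H (lastOr H Hs) ++ extent T (lastOr T Ts)
    extent-zip = trans (cong (extent (H ++ T)) (lastOr-zip H T Hs Ts)) (extent-++ H (lastOr H Hs) T (lastOr T Ts))

  IsParPoly-zip⇔ : ∀ {k} (Hs : Vec (Plateau a) k) (Ts : Vec (Plateau b) k) {ns ms} →
    (IsParPoly ns Hs × IsParPoly ms Ts) ⇔ IsParPoly (ns ++ ms) (zipWith _++_ Hs Ts)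
  IsParPoly-zip⇔ Hs Ts = mk⇔
    (λ ((neH , cH , zH , hH) , (neT , cT , zT , hT)) →
      All.zipWith All.++⁺ neH neT , Chain-zip⁺ cH cT ,
      Equivalence.from (Normalized-zip⇔ Hs Ts) (zH , zT) , Equivalence.from (HasHeights-zip⇔ Hs Ts) (hH , hT))
    (λ (ne , c , z , h) →
      let (neH , neT) = All-NonEmpty-zip⁻ Hs Ts ne
          (cH , cT)   = Chain-zip⁻ Hs Ts c
          (zH , zT)   = Equivalence.to (Normalized-zip⇔ Hs Ts) z
          (hH , hT)   = Equivalence.to (HasHeights-zip⇔ Hs Ts) h
      in (neH , cH , zH , hH) , (neT , cT , zT , hT))

ParPoly-++↔ : ∀ {a b k} {ns : Vec ℕ a} {ms : Vec ℕ b} →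
  (ParPoly (suc a) k ns × ParPoly (suc b) k ms) ↔ ParPoly (suc (a + b)) k (ns ++ ms)
ParPoly-++↔ {a} {b} {k} {ns} {ms} = begin
  (ParPoly (suc a) k ns × ParPoly (suc b) k ms)
    ↔⟨ ParPoly↔Σ ×-↔ ParPoly↔Σ ⟩
  (Σ _ (IsParPoly ns) × Σ _ (IsParPoly ms))
    ↔⟨ Σ×Σ↔Σ× ⟩
  Σ (Vec (Plateau a) k × Vec (Plateau b) k) (λ (Hs , Ts) → IsParPoly ns Hs × IsParPoly ms Ts)
    ↔⟨ Σ-↔ zip-++↔ (irrelevant-⇔⇒↔ (×-irrelevant IsParPoly-irrelevant IsParPoly-irrelevant)
                                    IsParPoly-irrelevant (IsParPoly-zip⇔ _ _)) ⟩
  Σ (Vec (Plateau (a + b)) k) (IsParPoly (ns ++ ms))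
    ↔⟨ ParPoly↔Σ ⟨
  ParPoly (suc (a + b)) k (ns ++ ms) ∎
  where open EquationalReasoning {k = bijection}

-- Parallelogram polyominoes as column chains

data Columns (N : ℕ) : ℕ → ℕ × ℕ → Set where
  last : ∀ {c} b → StepRel c (b , N) → Columns N 1 c
  next : ∀ {l c} b t → StepRel c (b , t) → Columns N (suc l) (b , t) → Columns N (suc (suc l)) c

top≤N : ∀ {N l b t} → Columns N l (b , t) → t ≤ N
top≤N (last _ (_ , t≤N , _))       = t≤N
top≤N (next _ _ (_ , t≤t₁ , _) cs) = ≤-trans t≤t₁ (top≤N cs)

module _ {N b t : ℕ} where

  Interval↔Columns₁ : t ≤ N → Interval b t ↔ Columns N 1 (b , t)
  Interval↔Columns₁ t≤N = mk↔ₛ′ to from to∘from (λ _ → refl)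
    where
    to : Interval b t → Columns N 1 (b , t)
    to (b₁ , b≤b₁ , b₁≤t) = last b₁ (b≤b₁ , t≤N , b₁≤t)
    from : Columns N 1 (b , t) → Interval b t
    from (last b₁ (b≤b₁ , _ , b₁≤t)) = b₁ , b≤b₁ , b₁≤t
    to∘from : ∀ cs → to (from cs) ≡ cs
    to∘from (last b₁ (b≤b₁ , t≤N′ , b₁≤t)) =
      cong (λ t≤N → last b₁ (b≤b₁ , t≤N , b₁≤t)) (≤-irrelevant t≤N t≤N′)

  Σ-Interval↔Columns : ∀ {l} →
    (Σ[ u ∈ Interval b t ] Σ[ v ∈ Interval t N ] Columns N (suc l) (proj₁ u , proj₁ v))
      ↔ Columns N (suc (suc l)) (b , t)
  Σ-Interval↔Columns {l} = mk↔ₛ′ to from (λ { (next _ _ _ _) → refl }) from∘to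
    where
    Σ-Columns = Σ[ u ∈ Interval b t ] Σ[ v ∈ Interval t N ] Columns N (suc l) (proj₁ u , proj₁ v)
    to : Σ-Columns → Columns N (suc (suc l)) (b , t)
    to ((b₁ , b≤b₁ , b₁≤t) , (t₁ , t≤t₁ , _) , cs) = next b₁ t₁ (b≤b₁ , t≤t₁ , b₁≤t) cs
    from : Columns N (suc (suc l)) (b , t) → Σ-Columns
    from (next b₁ t₁ (b≤b₁ , t≤t₁ , b₁≤t) cs) = (b₁ , b≤b₁ , b₁≤t) , (t₁ , t≤t₁ , top≤N cs) , cs
    from∘to : ∀ u → from (to u) ≡ u
    from∘to (u , (t₁ , t≤t₁ , t₁≤N) , cs) =
      cong (λ t₁≤N → u , (t₁ , t≤t₁ , t₁≤N) , cs) (≤-irrelevant (top≤N cs) t₁≤N)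

Fin-countColumns↔Columns : ∀ l {N b t} → b ≤ t → t ≤ N →
  Fin (countColumns l (N ∸ t) (N ∸ b)) ↔ Columns N (suc l) (b , t)
Fin-countColumns↔Columns zero {N} {b} {t} b≤t t≤N = begin
  Fin (suc ((N ∸ b) ∸ (N ∸ t))) ≡⟨ cong (Fin ∘ suc) (∸-gap b≤t t≤N) ⟩
  Fin (suc (t ∸ b))             ↔⟨ Fin↔Interval b≤t ⟩
  Interval b t                  ↔⟨ Interval↔Columns₁ t≤N ⟩
  Columns N 1 (b , t)           ∎
  where open EquationalReasoning {k = bijection}
Fin-countColumns↔Columns (suc l) {N} {b} {t} b≤t t≤N = begin
  Fin (∑[ i < suc ((N ∸ b) ∸ x) ] F (toℕ i))
    ≡⟨ cong (λ w → Fin (∑[ i < suc w ] F (toℕ i))) (∸-gap b≤t t≤N) ⟩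
  Fin (∑[ i < suc (t ∸ b) ] F (toℕ i))
    ↔⟨ Fin-sum↔Σ _ _ ⟩
  (Σ[ i ∈ Fin (suc (t ∸ b)) ] Fin (F (toℕ i)))
    ↔⟨ Σ-↔ ↔-refl (Fin-sum↔Σ _ _) ⟩
  (Σ[ i ∈ Fin (suc (t ∸ b)) ] Σ[ e ∈ Fin (suc x) ] Fin (countColumns l (toℕ e) (x + toℕ i)))
    ↔⟨ Σ-↔ (Fin↔Interval b≤t) (λ {i} → Σ-↔ (Fin↔Interval t≤N) (λ {e} → recurse i e)) ⟩
  (Σ[ u ∈ Interval b t ] Σ[ v ∈ Interval t N ] Columns N (suc l) (proj₁ u , proj₁ v))
    ↔⟨ Σ-Interval↔Columns ⟩
  Columns N (suc (suc l)) (b , t) ∎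
  where
  open EquationalReasoning {k = bijection}
  x = N ∸ t
  F : ℕ → ℕ
  F j = ∑[ e < suc x ] countColumns l (toℕ e) (x + j)
  recurse : (i : Fin (suc (t ∸ b))) (e : Fin (suc x)) →
    Fin (countColumns l (toℕ e) (x + toℕ i)) ↔ Columns N (suc l) (t ∸ toℕ i , N ∸ toℕ e)
  recurse i e =
    subst (λ n → Fin n ↔ Columns N (suc l) (t ∸ toℕ i , N ∸ toℕ e)) (cong₂ (countColumns l) top-depth bottom-depth)
      (Fin-countColumns↔Columns l (≤-trans (m∸n≤m t (toℕ i)) (∸-flip t≤N (toℕ≤pred[n] e))) (m∸n≤m N (toℕ e)))
    where
    top-depth : N ∸ (N ∸ toℕ e) ≡ toℕ e
    top-depth = m∸[m∸n]≡n (≤-trans (toℕ≤pred[n] e) (m∸n≤m N t))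
    bottom-depth : N ∸ (t ∸ toℕ i) ≡ x + toℕ i
    bottom-depth =
      trans (∸-split (m∸n≤m t (toℕ i)) t≤N) (cong (x +_) (m∸[m∸n]≡n (≤-trans (toℕ≤pred[n] i) (m∸n≤m t b))))

module _ {N : ℕ} where

  columns : ∀ {l c} → Columns N l c → Vec (Plateau 1) l
  columns (last b _)      = ((b , N) ∷ []) ∷ []
  columns (next b t _ cs) = ((b , t) ∷ []) ∷ columns cs

  columns-nonempty : ∀ {l c} (cs : Columns N l c) → All NonEmpty (columns cs)
  columns-nonempty (last b (_ , t≤N , b≤t))       = (≤-trans b≤t t≤N ∷ []) ∷ []
  columns-nonempty (next b t (_ , t≤t₁ , b≤t) cs) = (≤-trans b≤t t≤t₁ ∷ []) ∷ columns-nonempty cs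

  columns-chain : ∀ {l c} (cs : Columns N l c) → Chain ((c ∷ []) ∷ columns cs)
  columns-chain (last b r)      = cons (r ∷ []) one
  columns-chain (next b t r cs) = cons (r ∷ []) (columns-chain cs)

  columns-top : ∀ {l c} (P : Plateau 1) (cs : Columns N l c) → tops (lastOr P (columns cs)) ≡ N ∷ []
  columns-top P (last b _)      = refl
  columns-top P (next b t _ cs) = columns-top _ cs

  fromPlateaus : ∀ {l c} (Ps : Vec (Plateau 1) (suc l)) →
    Chain ((c ∷ []) ∷ Ps) → tops (lastOr (c ∷ []) Ps) ≡ N ∷ [] → Columns N (suc l) c
  fromPlateaus (((b , _) ∷ []) ∷ [])     (cons (r ∷ []) one) refl = last b r
  fromPlateaus (((b , t) ∷ []) ∷ Q ∷ Qs) (cons (r ∷ []) ch)  e    = next b t r (fromPlateaus (Q ∷ Qs) ch e)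

  columns-fromPlateaus : ∀ {l c} (Ps : Vec (Plateau 1) (suc l)) ch e → columns (fromPlateaus {l} {c} Ps ch e) ≡ Ps
  columns-fromPlateaus (_ ∷ [])     (cons (_ ∷ []) one) refl = refl
  columns-fromPlateaus (P ∷ Q ∷ Qs) (cons (_ ∷ []) ch)  e    = cong (P ∷_) (columns-fromPlateaus (Q ∷ Qs) ch e)

  fromPlateaus-columns : ∀ {l c} (cs : Columns N (suc l) c) ch e → fromPlateaus (columns cs) ch e ≡ cs
  fromPlateaus-columns (last b r) (cons (r′ ∷ []) one) refl = cong (last b) (StepRel-irrelevant r′ r)
  fromPlateaus-columns (next b t r cs@(last _ _)) (cons (r′ ∷ []) ch) e =
    cong₂ (next b t) (StepRel-irrelevant r′ r) (fromPlateaus-columns cs ch e)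
  fromPlateaus-columns (next b t r cs@(next _ _ _ _)) (cons (r′ ∷ []) ch) e =
    cong₂ (next b t) (StepRel-irrelevant r′ r) (fromPlateaus-columns cs ch e)

extent₁-top : ∀ {N} (B L : Plateau 1) → bottoms B ≡ 0 ∷ [] → extent B L ≡ suc N ∷ [] → tops L ≡ N ∷ []
extent₁-top (_ ∷ []) (_ ∷ []) refl refl = refl

extent₁≢0 : ∀ (B L : Plateau 1) → bottoms B ≡ 0 ∷ [] → extent B L ≢ 0 ∷ []
extent₁≢0 (_ ∷ []) (_ ∷ []) refl ()

ParPoly²-height0 : ∀ {k} → ParPoly 2 k (0 ∷ []) → ⊥
ParPoly²-height0 (parpoly (P ∷ Ps) _ _ nz h) = extent₁≢0 P (lastOr P Ps) nz h

-- A polyomino is a column chain following the virtual column [0, 0], which forces β₁ = 0.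
module _ {N k : ℕ} where

  columns-isParPoly : (cs : Columns N (suc k) (0 , 0)) → IsParPoly (suc N ∷ []) (columns cs)
  columns-isParPoly cs@(last b (_ , _ , b≤0)) =
    columns-nonempty cs , Chain-tail (columns-chain cs) , cong (_∷ []) b≡0 , cong (λ b → suc N ∸ b ∷ []) b≡0
    where b≡0 = n≤0⇒n≡0 b≤0
  columns-isParPoly cs@(next b t (_ , _ , b≤0) cs′) =
    columns-nonempty cs , Chain-tail (columns-chain cs) , cong (_∷ []) b≡0 ,
    cong₂ (λ b ts → zipWith (λ b t → suc t ∸ b) (b ∷ []) ts) b≡0 (columns-top _ cs′)
    where b≡0 = n≤0⇒n≡0 b≤0

  ParPoly²↔Columns : ParPoly 2 (suc k) (suc N ∷ []) ↔ Columns N (suc k) (0 , 0)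
  ParPoly²↔Columns = mk↔ₛ′ to from to∘from from∘to
    where
    to : ParPoly 2 (suc k) (suc N ∷ []) → Columns N (suc k) (0 , 0)
    to (parpoly (P@((b , t) ∷ []) ∷ Ps) _ ch nz h) =
      fromPlateaus (P ∷ Ps) (cons ((z≤n , z≤n , ≤-reflexive b≡0) ∷ []) ch) (extent₁-top P (lastOr P Ps) nz h)
      where b≡0 = ∷-injectiveˡ nz
    from : Columns N (suc k) (0 , 0) → ParPoly 2 (suc k) (suc N ∷ [])
    from cs = let (ne , c , z , h) = columns-isParPoly cs in parpoly (columns cs) ne c z h
    to∘from : ∀ cs → to (from cs) ≡ cs
    to∘from cs@(last _ _)     = fromPlateaus-columns cs _ _
    to∘from cs@(next _ _ _ _) = fromPlateaus-columns cs _ _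
    from∘to : ∀ p → from (to p) ≡ p
    from∘to (parpoly (P@((b , t) ∷ []) ∷ Ps) _ _ _ _) = ParPoly-≡ (columns-fromPlateaus (P ∷ Ps) _ _)

Fin-parallelogramCount↔ParPoly : ∀ k n → Fin (parallelogramCount (suc k) n) ↔ ParPoly 2 (suc k) (n ∷ [])
Fin-parallelogramCount↔ParPoly k zero    =
  mk↔ₛ′ (λ ()) (⊥-elim ∘ ParPoly²-height0) (⊥-elim ∘ ParPoly²-height0) (λ ())
Fin-parallelogramCount↔ParPoly k (suc N) = begin
  Fin (countColumns k N N)       ↔⟨ Fin-countColumns↔Columns k z≤n z≤n ⟩
  Columns N (suc k) (0 , 0)      ↔⟨ ParPoly²↔Columns ⟨
  ParPoly 2 (suc k) (suc N ∷ []) ∎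
  where open EquationalReasoning {k = bijection}

Fin-∏↔ParPoly : ∀ {m} k (ns : Vec ℕ (suc m)) →
  Fin (prodV (map (parallelogramCount (suc k)) ns)) ↔ ParPoly (suc (suc m)) (suc k) ns
Fin-∏↔ParPoly k (n ∷ []) =
  subst (λ c → Fin c ↔ ParPoly 2 (suc k) (n ∷ [])) (sym (*-identityʳ _)) (Fin-parallelogramCount↔ParPoly k n)
Fin-∏↔ParPoly {suc m} k (n ∷ ns) = begin
  Fin (parallelogramCount (suc k) n * prodV (map (parallelogramCount (suc k)) ns))
    ↔⟨ *↔× ⟩
  (Fin (parallelogramCount (suc k) n) × Fin (prodV (map (parallelogramCount (suc k)) ns)))
    ↔⟨ Fin-parallelogramCount↔ParPoly k n ×-↔ Fin-∏↔ParPoly k ns ⟩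
  (ParPoly 2 (suc k) (n ∷ []) × ParPoly (suc (suc m)) (suc k) ns)
    ↔⟨ ParPoly-++↔ ⟩
  ParPoly (suc (suc (suc m))) (suc k) (n ∷ ns) ∎
  where open EquationalReasoning {k = bijection}

theorem6 : (d k : ℕ) → 4 ≤ d → 1 ≤ k → (ns : Vec ℕ (d ∸ 1)) → All (1 ≤_) ns →
    Σ ℕ (λ s → (Fin s ↔ ParPoly d k ns) ×
      (k ^ (d ∸ 1) * prodV (map (λ n → n + k ∸ 1) ns) * s
        ≡ prodV (map (λ n → n * (((n + k ∸ 1) C (k ∸ 1)) ^ 2)) ns)))
theorem6 (suc (suc m)) (suc k) _ _ ns _ =
  prodV (map (parallelogramCount (suc k)) ns) , Fin-∏↔ParPoly k ns , ∏-parallelogramCount-formula k ns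
theorem6 0             _       ()         _  _ _
theorem6 1             _       (s≤s ())   _  _ _
theorem6 (suc (suc m)) 0       _          () _ _
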